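{- For every integer $d\geq 1$, every $b_1,\dots,b_d,b_{d+1}\in\mathbb{N}$ with $b_i\geq 2$ for all $i\in\{1,\dots,d+1\}$, every integer $k\geq 1$ and every real $0<\varepsilon\leq 1$, \[ \mathrm{UDHL}(b_1,\dots,b_{d+1}\,|\,k,\varepsilon)\leq \mathrm{UDHL}\big(b_1,\dots,b_d\,\big|\,\mathrm{LS}(b_1,\dots,b_{d+1}\,|\,k,\varepsilon/2),\,\varepsilon/2\big). \]
   Context: Trees, strong subtrees, level sets, homogeneous trees (strong subtrees of $b^{<\mathbb{N}}$, the tree of finite sequences in $\{0,\dots,b-1\}$ under end-extension, with branching number $b_T=b$), vector trees $\mathbf{T}=(T_1,\dots,T_d)$ with level product $\otimes\mathbf{T}=\bigcup_n T_1(n)\times\dots\times T_d(n)$, vector strong subtrees (tuples of strong subtrees with a common level set), (finite) vector homogeneous trees and $b_{\mathbf{T}}$ are as usual: a strong subtree $S$ of a uniquely rooted tree $T$ is a uniquely rooted, balanced subtree each of whose levels lies in a level of $T$ and such that every immediate successor in $T$ of a non-maximal $s\in S$ lies below a unique immediate successor of $s$ in $S$; its level set $L_T(S)$ is the set of $m$ with some level of $S$ contained in $T(m)$. For $F\subseteq W(n)$, $\mathrm{dens}(F)=|F|/|W(n)|$. A level selection is a map $D:\otimes\mathbf{T}\to\mathcal{P}(W)$, $\mathbf{T}$ a finite vector homogeneous tree and $W$ a homogeneous tree, for which there are $l_0<\dots<l_{h(\mathbf{T})-1}$ with $D(\mathbf{t})\subseteq W(l_n)$ whenever $\mathbf{t}\in\otimes\mathbf{T}(n)$;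 its height is $h(\mathbf{T})$ and its density is $\delta(D)=\min_{\mathbf{t}}\mathrm{dens}(D(\mathbf{t}))$. $\mathrm{UDHL}(b_1,\dots,b_d|k,\varepsilon)$ is the least integer $N$ such that: whenever $(T_1,\dots,T_d)$ are homogeneous trees with branching numbers $b_1,\dots,b_d$, $L\subseteq\mathbb{N}$ is finite with $|L|\geq N$ and $D\subseteq\bigcup_n T_1(n)\times\dots\times T_d(n)$ satisfies $|D\cap(T_1(n)\times\dots\times T_d(n))|\geq\varepsilon|T_1(n)\times\dots\times T_d(n)|$ for all $n\in L$, there are strong subtrees $(S_1,\dots,S_d)$ of height $k$ with common level set whose level product is contained in $D$ (such $N$ exists for all parameters). $\mathrm{LS}(b_1,\dots,b_{d+1}|k,\varepsilon)$ is the least integer $N$ such that: whenever $\mathbf{T}$ is a finite vector homogeneous tree with $b_{\mathbf{T}}=(b_1,\dots,b_d)$, $W$ a homogeneous tree with $b_W=b_{d+1}$, and $D:\otimes\mathbf{T}\to\mathcal{P}(W)$ a level selection with $\delta(D)\geq\varepsilon$ and height at least $N$, there exist a vector strong subtree $\mathbf{S}$ of $\mathbf{T}$ and a strong subtree $R$ of $W$ with $h(\mathbf{S})=h(R)=k$ and $R(n)\subseteq\bigcap_{\mathbf{s}\in\otimes\mathbf{S}(n)}D(\mathbf{s})$ for all $n<k$ (such $N$ exists for all parameters). -}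

module Defs where

open import Data.Nat as ℕ using (ℕ; zero; suc; _<_; _≤_)
open import Data.Fin using (Fin)
import Data.Fin as F
open import Data.List using (List; []; _∷_; _++_; length)
open import Data.List.Membership.Propositional using (_∈_)
open import Data.List.Relation.Unary.Unique.Propositional using (Unique)
open import Data.Vec as Vec using (Vec; _∷ʳ_)
open import Data.Vec.Relation.Unary.All as All using (All)
open import Data.Product using (Σ; _×_; _,_; ∃)
open import Data.Sum using (_⊎_)
open import Data.Unit using (⊤)
open import Relation.Nullary using (¬_)
open import Relation.Binary.PropositionalEquality using (_≡_)
open import Data.Integer using (+_)
open import Data.Rational as ℚ using (ℚ; 0ℚ; 1ℚ)

record HasCard {A : Set} (P : A → Set) (n : ℕ) : Set where
  field
    elems    : List A
    unique   : Unique elems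
    len      : length elems ≡ n
    sound    : ∀ {x} → x ∈ elems → P x
    complete : ∀ {x} → P x → x ∈ elems

-- Real numbers as Dedekind cuts (L q : q < x,  U q : x < q)

record Real : Set₁ where
  field
    L : ℚ → Set
    U : ℚ → Set
    inhabitedL : Σ ℚ L
    inhabitedU : Σ ℚ U
    roundedL   : ∀ q → (L q → Σ ℚ λ r → (q ℚ.< r) × L r) × ((Σ ℚ λ r → (q ℚ.< r) × L r) → L q)
    roundedU   : ∀ q → (U q → Σ ℚ λ r → (r ℚ.< q) × U r) × ((Σ ℚ λ r → (r ℚ.< q) × U r) → U q)
    disjoint   : ∀ q → ¬ (L q × U q)
    located    : ∀ q r → q ℚ.< r → L q ⊎ U r

-- A lower cut  ε : ℚ → Set  (ε q means q < ε).
-- "c ≥ ε · t" for naturals c, t:  every rational q < ε has q·t ≤ c.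
_·_≤ᶜ_ : (ℚ → Set) → ℕ → ℕ → Set
ε · t ≤ᶜ c = ∀ q → ε q → (q ℚ.* ((+ t) ℚ./ 1)) ℚ.≤ ((+ c) ℚ./ 1)

half : (ℚ → Set) → (ℚ → Set)
half ε q = ε (q ℚ.+ q)

-- The tree b^{<ℕ}: finite sequences over {0,…,b-1}, ordered by end-extension.

Seq : ℕ → Set
Seq b = List (Fin b)

_⊑_ : ∀ {b} → Seq b → Seq b → Set
s ⊑ t = Σ _ λ u → s ++ u ≡ t

_⊏_ : ∀ {b} → Seq b → Seq b → Set
s ⊏ t = Σ _ λ a → Σ _ λ u → s ++ (a ∷ u) ≡ t

-- subtrees (subsets of b^{<ℕ} with the induced order)
Tree : ℕ → Set₁
Tree b = Seq b → Set

Full : (b : ℕ) → Tree b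
Full b _ = ⊤

module _ {b : ℕ} where

  Level : Tree b → ℕ → Seq b → Set
  Level T n t = T t × HasCard (λ s → T s × s ⊏ t) n

  NonEmptyLevel : Tree b → ℕ → Set
  NonEmptyLevel T n = Σ (Seq b) (Level T n)

  Height : Tree b → ℕ → Set
  Height T k = (∀ n → n < k → NonEmptyLevel T n) × ¬ NonEmptyLevel T k

  Infinite : Tree b → Set
  Infinite T = ∀ n → NonEmptyLevel T n

  Minimal : Tree b → Seq b → Set
  Minimal T r = T r × (∀ s → T s → ¬ (s ⊏ r))

  MaximalIn : Tree b → Seq b → Set
  MaximalIn T s = T s × (∀ t → T t → ¬ (s ⊏ t))

  UniquelyRooted : Tree b → Set
  UniquelyRooted T = Σ (Seq b) λ r → Minimal T r × (∀ r' → Minimal T r' → r' ≡ r)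

  Chain : Tree b → Tree b → Set
  Chain T C = (∀ s → C s → T s) × (∀ s t → C s → C t → (s ⊑ t) ⊎ (t ⊑ s))

  MaximalChain : Tree b → Tree b → Set
  MaximalChain T C = Chain T C × (∀ s → T s → Chain T (λ x → C x ⊎ x ≡ s) → C s)

  Balanced : Tree b → Set₁
  Balanced T = ∀ C C' → MaximalChain T C → MaximalChain T C' → ∀ n → HasCard C n → HasCard C' n

  ImmSucc : Tree b → Seq b → Seq b → Set
  ImmSucc T s t = T t × (s ⊏ t) × (∀ u → T u → s ⊏ u → ¬ (u ⊏ t))

  StrongSubtree : Tree b → Tree b → Set₁
  StrongSubtree T S =
    (∀ s → S s → T s) ×
    UniquelyRooted S ×
    Balanced S ×
    (∀ n → Σ ℕ λ m → ∀ s → Level S n s → Level T m s) ×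
    (∀ s → S s → ¬ MaximalIn S s → ∀ t → ImmSucc T s t →
       Σ (Seq b) λ s' → (ImmSucc S s s' × t ⊑ s') ×
         (∀ s'' → ImmSucc S s s'' × t ⊑ s'' → s'' ≡ s'))

  LevelSet : Tree b → Tree b → ℕ → Set
  LevelSet T S m = Σ ℕ λ n → NonEmptyLevel S n × (∀ s → Level S n s → Level T m s)

  Homogeneous : Tree b → Set₁
  Homogeneous T = StrongSubtree (Full b) T

  DensGe : (ℚ → Set) → Tree b → Tree b → Set
  DensGe ε W F = Σ ℕ λ n → NonEmptyLevel W n × (∀ w → F w → Level W n w) ×
    (Σ ℕ λ c → Σ ℕ λ t → HasCard F c × HasCard (Level W n) t × (ε · t ≤ᶜ c))

get : ∀ {a} {d} {P : ℕ → Set a} {bs : Vec ℕ d} → All P bs → (i : Fin d) → P (Vec.lookup bs i)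
get (px All.∷ _)  F.zero    = px
get (_ All.∷ pxs) (F.suc i) = get pxs i

Tuple : ∀ {d} → Vec ℕ d → Set
Tuple bs = All Seq bs

VTree : ∀ {d} → Vec ℕ d → Set₁
VTree bs = All Tree bs

module _ {d : ℕ} {bs : Vec ℕ d} where

  LevelProd : VTree bs → ℕ → Tuple bs → Set
  LevelProd T n t = ∀ i → Level (get T i) n (get t i)

  CommonLevelSet : VTree bs → VTree bs → Set
  CommonLevelSet T S = ∀ i j m → LevelSet (get T i) (get S i) m → LevelSet (get T j) (get S j) m

  VStrongSubtree : VTree bs → VTree bs → Set₁
  VStrongSubtree T S = (∀ i → StrongSubtree (get T i) (get S i)) × CommonLevelSet T S

  FinVHomogeneous : VTree bs → ℕ → Set₁
  FinVHomogeneous T h = ∀ i → Homogeneous (get T i) × Height (get T i) h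

  IsLevelSelection : ∀ {b} → VTree bs → ℕ → Tree b → (Tuple bs → Tree b) → Set
  IsLevelSelection T h W D =
    Σ (ℕ → ℕ) λ l → (∀ m n → m < n → n < h → l m < l n) ×
      (∀ n t → n < h → LevelProd T n t → ∀ w → D t w → Level W (l n) w)

IsLeast : (ℕ → Set₁) → ℕ → Set₁
IsLeast P N = P N × (∀ M → P M → N ≤ M)

-- the property defining UDHL(b_1,…,b_d | k, ε) (ε given by its lower cut)
UDHLProp : ∀ {d} → Vec ℕ d → ℕ → (ℚ → Set) → ℕ → Set₁
UDHLProp bs k ε N =
  (T : VTree bs) → (∀ i → Homogeneous (get T i) × Infinite (get T i)) →
  (L : List ℕ) → Unique L → N ≤ length L →
  (D : Tuple bs → Set) → (∀ t → D t → Σ ℕ λ n → LevelProd T n t) →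
  (∀ n → n ∈ L → Σ ℕ λ c → Σ ℕ λ m →
     HasCard (λ t → D t × LevelProd T n t) c × HasCard (LevelProd T n) m × (ε · m ≤ᶜ c)) →
  Σ (VTree bs) λ S → (∀ i → StrongSubtree (get T i) (get S i) × Height (get S i) k) ×
    CommonLevelSet T S × (∀ n t → LevelProd S n t → D t)

-- the property defining LS(b_1,…,b_d,b | k, ε)
LSProp : ∀ {d} → Vec ℕ d → ℕ → ℕ → (ℚ → Set) → ℕ → Set₁
LSProp bs b k ε N =
  (T : VTree bs) (h : ℕ) → FinVHomogeneous T h →
  (W : Tree b) → Homogeneous W →
  (D : Tuple bs → Tree b) → IsLevelSelection T h W D → N ≤ h →
  (∀ n t → LevelProd T n t → DensGe ε W (D t)) →
  Σ (VTree bs) λ S → Σ (Tree b) λ R →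
    VStrongSubtree T S × (∀ i → Height (get S i) k) ×
    StrongSubtree W R × Height R k ×
    (∀ n → n < k → ∀ w → Level R n w → ∀ s → LevelProd S n s → D s w)

-- Write T = (T′, W) with T′ the first d trees. At a level n ∈ L, D has density ε, so averaging over
-- the fibres D_t = {w : (t, w) ∈ D} of the tuples t ∈ T′(n) shows that the tuples whose fibre has
-- density ≥ ε/2 in W(n) have density ≥ ε/2 in T′(n); since ε is a real number, the averaging is
-- done through a rational window (4 + A)/N < ε < (8 + A)/N. UDHL for (b₁, …, b_d) yields a vector
-- strong subtree S of T′ of height M = LS(b₁, …, b_{d+1} | k, ε/2) all of whose level tuples are
-- such tuples, so t ↦ D_t is a level selection on S of density ≥ ε/2. LS then gives S′ ≤ S and
-- R ≤ W of height k with R(n) ⊆ D_t for every t ∈ ⊗S′(n), and (S′, R) is the required vector strong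
-- subtree of T.
module Submission where

open import Data.Nat using (ℕ)
open import Data.Fin using (Fin)
open import Data.Vec using (Vec; _∷ʳ_)
import Data.Rational as ℚ
open import Data.Rational using (0ℚ; 1ℚ)
open import Relation.Binary.Definitions using (DecidableEquality)
open import Relation.Binary.PropositionalEquality using (_≡_)
open import Defs using (Real)

module Cardinality {A : Set} (_≟_ : DecidableEquality A) where

  open import Data.Nat using (ℕ; suc; _≤_; s≤s; z≤n)
  open import Data.Nat.Properties using (suc-injective)
  open import Data.List using (List; _∷_; length; filter; map; deduplicate)
  open import Data.List.Properties using (length-filter)
  open import Data.List.Membership.Propositional using (_∈_)
  open import Data.List.Membership.Propositional.Properties
    using (∈-filter⁺; ∈-filter⁻; ∈-map⁺; ∈-map⁻; ∈-deduplicate⁺; ∈-deduplicate⁻)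
  open import Data.List.Membership.Propositional.Properties.WithK using (unique∧set⇒bag)
  open import Data.List.Membership.DecPropositional _≟_ using (_∈?_)
  open import Data.List.Relation.Unary.Any using (here; there)
  open import Data.List.Relation.Unary.All as All using (All)
  open import Data.List.Relation.Unary.AllPairs using (_∷_)
  open import Data.List.Relation.Unary.Unique.Propositional using (Unique)
  import Data.List.Relation.Unary.Unique.Propositional.Properties as Unique
  open import Data.List.Relation.Unary.Unique.DecPropositional.Properties _≟_ using (deduplicate-!)
  open import Data.List.Relation.Binary.Subset.Propositional using (_⊆_)
  open import Data.List.Relation.Binary.BagAndSetEquality using (∼bag⇒↭)
  open import Data.List.Relation.Binary.Permutation.Propositional.Properties using (↭-length)
  open import Data.Product using (Σ; ∃; _×_; _,_; proj₁; proj₂)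
  open import Function.Bundles using (_⇔_; mk⇔; Equivalence)
  open import Relation.Nullary using (¬?; yes; no)
  open import Relation.Unary using (Decidable)
  open import Relation.Binary.PropositionalEquality using (_≡_; _≢_; refl; sym; trans; subst)
  open import Defs using (HasCard)

  unique∧set⇒length≡ : ∀ {xs ys : List A} → Unique xs → Unique ys →
                       (∀ {x} → x ∈ xs ⇔ x ∈ ys) → length xs ≡ length ys
  unique∧set⇒length≡ uxs uys xs≈ys = ↭-length (∼bag⇒↭ (unique∧set⇒bag uxs uys xs≈ys))

  unique∧⊆⇒length≤ : ∀ {xs ys : List A} → Unique xs → Unique ys → xs ⊆ ys → length xs ≤ length ys
  unique∧⊆⇒length≤ {xs} {ys} uxs uys xs⊆ys =
    subst (_≤ length ys) (sym (unique∧set⇒length≡ uxs (Unique.filter⁺ (_∈? xs) {ys} uys) xs≈ys∩xs))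
      (length-filter (_∈? xs) ys)
    where
    xs≈ys∩xs : ∀ {x} → x ∈ xs ⇔ x ∈ filter (_∈? xs) ys
    xs≈ys∩xs = mk⇔ (λ x∈xs → ∈-filter⁺ (_∈? xs) (xs⊆ys x∈xs) x∈xs)
                   (λ x∈ → proj₂ (∈-filter⁻ (_∈? xs) {xs = ys} x∈))

  module _ {P : A → Set} where
    open HasCard

    HasCard-unique : ∀ {m n} → HasCard P m → HasCard P n → m ≡ n
    HasCard-unique cm cn = trans (sym (len cm)) (trans (unique∧set⇒length≡ (unique cm) (unique cn)
      (mk⇔ (λ p → complete cn (sound cm p)) (λ p → complete cm (sound cn p)))) (len cn))

    HasCard-cong : ∀ {Q : A → Set} {n} → (∀ {x} → P x ⇔ Q x) → HasCard P n → HasCard Q n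
    HasCard-cong P⇔Q cn = record
      { elems = elems cn ; unique = unique cn ; len = len cn
      ; sound = λ x∈ → Equivalence.to P⇔Q (sound cn x∈)
      ; complete = λ Qx → complete cn (Equivalence.from P⇔Q Qx) }

    HasCard-positive : ∀ {n x} → HasCard P n → P x → 1 ≤ n
    HasCard-positive cn Px with elems cn | complete cn Px | len cn
    ... | _ ∷ _ | _ | refl = s≤s z≤n

    HasCard-remove : ∀ {n y} → HasCard P (suc n) → P y → HasCard (λ x → P x × x ≢ y) n
    HasCard-remove {n} {y} cn Py = record
      { elems    = others
      ; unique   = others-unique
      ; len      = suc-injective
                     (trans (unique∧set⇒length≡ (y∉others ∷ others-unique) (unique cn) y∷others≈) (len cn))
      ; sound    = λ x∈ → let (x∈elems , x≢y) = ∈-filter⁻ ≢y? x∈ in sound cn x∈elems , x≢y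
      ; complete = λ (Px , x≢y) → ∈-filter⁺ ≢y? (complete cn Px) x≢y
      }
      where
      ≢y? : Decidable (_≢ y)
      ≢y? x = ¬? (x ≟ y)
      others : List A
      others = filter ≢y? (elems cn)
      others-unique : Unique others
      others-unique = Unique.filter⁺ ≢y? {elems cn} (unique cn)
      y∉others : All (y ≢_) others
      y∉others = All.tabulate λ x∈ y≡x → proj₂ (∈-filter⁻ ≢y? {xs = elems cn} x∈) (sym y≡x)
      y∷others≈ : ∀ {x} → x ∈ y ∷ others ⇔ x ∈ elems cn
      y∷others≈ {x} = mk⇔ (λ { (here refl) → complete cn Py ; (there x∈) → proj₁ (∈-filter⁻ ≢y? x∈) }) from
        where
        from : x ∈ elems cn → x ∈ y ∷ others
        from x∈ with x ≟ y
        ... | yes refl = here refl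
        ... | no x≢y = there (∈-filter⁺ ≢y? x∈ x≢y)

  HasCard-image : ∀ {C : Set} {P : A → Set} {Q : C → Set} {n} (f : C → A) → HasCard Q n →
                  (∀ {x} → P x ⇔ ∃ λ u → Q u × f u ≡ x) → Σ ℕ (HasCard P)
  HasCard-image f cQ image = length image-list , record
    { elems = image-list
    ; unique = deduplicate-! (map f (elems cQ))
    ; len = refl
    ; sound = λ x∈ → let (u , u∈ , fu≡x) = ∈-map⁻ f (∈-deduplicate⁻ _≟_ (map f (elems cQ)) x∈) in
                     Equivalence.from image (u , sound cQ u∈ , sym fu≡x)
    ; complete = λ Px → let (u , Qu , fu≡x) = Equivalence.to image Px in
                        ∈-deduplicate⁺ _≟_ (subst (_∈ map f (elems cQ)) fu≡x (∈-map⁺ f (complete cQ Qu)))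
    }
    where
    open HasCard
    image-list : List A
    image-list = deduplicate _≟_ (map f (elems cQ))

module Prefix {b : ℕ} where

  open import Data.Nat using (_<_; s≤s; z≤n)
  open import Data.Nat.Properties using (m<m+n; <-irrefl)
  open import Data.Fin using (Fin)
  import Data.Fin as Fin
  open import Data.List using ([]; _∷_; _++_; length)
  open import Data.List.Properties using (++-identityʳ; ++-assoc; length-++; ≡-dec)
  open import Data.Product using (_×_; _,_; proj₁; proj₂)
  open import Data.Sum using (_⊎_; inj₁; inj₂)
  open import Relation.Nullary using (¬_; Dec; yes; no)
  open import Relation.Binary.Definitions using (DecidableEquality)
  open import Relation.Binary.PropositionalEquality using (_≡_; refl; sym; trans; cong; subst)
  open import Defs using (Seq; _⊑_; _⊏_)

  _≟_ : DecidableEquality (Seq b)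
  _≟_ = ≡-dec Fin._≟_

  ⊑-refl : ∀ {s : Seq b} → s ⊑ s
  ⊑-refl {s} = [] , ++-identityʳ s

  ⊑-trans : ∀ {s t u : Seq b} → s ⊑ t → t ⊑ u → s ⊑ u
  ⊑-trans {s} (v , refl) (w , refl) = v ++ w , sym (++-assoc s v w)

  ⊏⇒⊑ : ∀ {s t : Seq b} → s ⊏ t → s ⊑ t
  ⊏⇒⊑ (a , u , e) = a ∷ u , e

  ⊑-⊏-trans : ∀ {s t u : Seq b} → s ⊑ t → t ⊏ u → s ⊏ u
  ⊑-⊏-trans {s} ([] , refl) (a , w , refl) = a , w , cong (_++ a ∷ w) (sym (++-identityʳ s))
  ⊑-⊏-trans {s} (c ∷ v , refl) (a , w , refl) = c , v ++ a ∷ w , sym (++-assoc s (c ∷ v) (a ∷ w))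

  ⊏-trans : ∀ {s t u : Seq b} → s ⊏ t → t ⊏ u → s ⊏ u
  ⊏-trans s⊏t = ⊑-⊏-trans (⊏⇒⊑ s⊏t)

  ⊏⇒length< : ∀ {s t : Seq b} → s ⊏ t → length s < length t
  ⊏⇒length< {s} (a , u , refl) = subst (length s <_) (sym (length-++ s)) (m<m+n (length s) (s≤s z≤n))

  ⊏-irrefl : ∀ {s : Seq b} → ¬ (s ⊏ s)
  ⊏-irrefl s⊏s = <-irrefl refl (⊏⇒length< s⊏s)

  ⊑⇒≡⊎⊏ : ∀ {s t : Seq b} → s ⊑ t → s ≡ t ⊎ s ⊏ t
  ⊑⇒≡⊎⊏ {s} ([] , e) = inj₁ (trans (sym (++-identityʳ s)) e)
  ⊑⇒≡⊎⊏ (a ∷ u , e) = inj₂ (a , u , e)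

  ∷-⊑ : ∀ {a : Fin b} {s t} → s ⊑ t → (a ∷ s) ⊑ (a ∷ t)
  ∷-⊑ (u , e) = u , cong (_ ∷_) e

  ∷-⊑⁻ : ∀ {a c : Fin b} {s t} → (a ∷ s) ⊑ (c ∷ t) → a ≡ c × s ⊑ t
  ∷-⊑⁻ (u , refl) = refl , (u , refl)

  ⊑-total-below : ∀ {s t x : Seq b} → s ⊑ x → t ⊑ x → s ⊑ t ⊎ t ⊑ s
  ⊑-total-below {[]} _ _ = inj₁ (_ , refl)
  ⊑-total-below {_ ∷ _} {[]} _ _ = inj₂ (_ , refl)
  ⊑-total-below {_ ∷ _} {_ ∷ _} {[]} (_ , ()) _
  ⊑-total-below {_ ∷ _} {_ ∷ _} {_ ∷ _} s⊑x t⊑x with ∷-⊑⁻ s⊑x | ∷-⊑⁻ t⊑x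
  ... | refl , s⊑x′ | refl , t⊑x′ with ⊑-total-below s⊑x′ t⊑x′
  ...   | inj₁ s⊑t = inj₁ (∷-⊑ s⊑t)
  ...   | inj₂ t⊑s = inj₂ (∷-⊑ t⊑s)

  _⊑?_ : (s t : Seq b) → Dec (s ⊑ t)
  [] ⊑? t = yes (t , refl)
  (a ∷ s) ⊑? [] = no λ { (_ , ()) }
  (a ∷ s) ⊑? (c ∷ t) with a Fin.≟ c | s ⊑? t
  ... | yes refl | yes s⊑t = yes (∷-⊑ s⊑t)
  ... | yes refl | no s⋢t  = no λ as⊑ct → s⋢t (proj₂ (∷-⊑⁻ as⊑ct))
  ... | no a≢c   | _       = no λ as⊑ct → a≢c (proj₁ (∷-⊑⁻ as⊑ct))

module Levels {b : ℕ} where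

  open import Data.Nat using (zero; suc; _+_; _∸_; _≤_; _<_; _≤?_; s≤s)
  open import Data.Nat.Properties using (<-irrefl; <-≤-trans; ≰⇒>; m∸n+n≡m)
  open import Data.List using (_∷_; length)
  open import Data.List.Extrema.Nat using (argmax; argmax-all; f[⊥]≤f[argmax]; f[xs]≤f[argmax])
  open import Data.List.Membership.Propositional using (_∈_)
  open import Data.List.Relation.Unary.Any using (here; there)
  open import Data.List.Relation.Unary.All as All using (All)
  open import Data.List.Relation.Unary.AllPairs using (_∷_)
  open import Data.Product using (Σ; _×_; _,_; proj₁; proj₂)
  open import Data.Sum using (inj₁; inj₂; [_,_])
  open import Function using (id)
  open import Data.Empty using (⊥-elim)
  open import Function.Bundles using (_⇔_; mk⇔)
  open import Relation.Nullary using (¬_; yes; no)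
  open import Relation.Binary.PropositionalEquality using (_≡_; _≢_; refl; sym; subst; subst₂)
  open import Defs
  open Prefix {b}
  open Cardinality _≟_

  module _ {T : Tree b} where

    level-unique : ∀ {m n x} → Level T m x → Level T n x → m ≡ n
    level-unique (_ , cm) (_ , cn) = HasCard-unique cm cn

    level-<-mono : ∀ {m n x y} → Level T m x → Level T n y → x ⊏ y → m < n
    level-<-mono {m} {n} {x} (Tx , cm) (_ , cn) x⊏y =
      subst₂ _<_ (HasCard.len cm) (HasCard.len cn)
        (unique∧⊆⇒length≤ (x∉ ∷ HasCard.unique cm) (HasCard.unique cn) x∷preds⊆)
      where
      x∉ : All (x ≢_) (HasCard.elems cm)
      x∉ = All.tabulate λ s∈ x≡s → ⊏-irrefl (subst (_⊏ x) (sym x≡s) (proj₂ (HasCard.sound cm s∈)))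
      x∷preds⊆ : ∀ {s} → s ∈ x ∷ HasCard.elems cm → s ∈ HasCard.elems cn
      x∷preds⊆ (here refl) = HasCard.complete cn (Tx , x⊏y)
      x∷preds⊆ (there s∈) =
        let (Ts , s⊏x) = HasCard.sound cm s∈ in HasCard.complete cn (Ts , ⊏-trans s⊏x x⊏y)

    -- The predecessors of x form a chain, so the longest one, y, lies directly below x and the
    -- remaining ones are exactly the predecessors of y.
    level-predecessor : ∀ {n x} → Level T (suc n) x → Σ (Seq b) λ y → Level T n y × y ⊏ x
    level-predecessor {n} {x} (Tx , cx) =
      y , (Ty , HasCard-cong below-y (HasCard-remove cx (Ty , y⊏x))) , y⊏x
      where
      open HasCard cx
      longest : Σ (Seq b) λ y → y ∈ elems × (∀ {s} → s ∈ elems → length s ≤ length y)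
      longest with elems | len
      ... | z ∷ zs | _ =
        argmax length z zs , argmax-all length {P = _∈ z ∷ zs} (here refl) (All.tabulate there) ,
        All.lookup (f[⊥]≤f[argmax] {f = length} z zs All.∷ f[xs]≤f[argmax] {f = length} z zs)
      y : Seq b
      y = proj₁ longest
      Ty : T y
      Ty = proj₁ (sound (proj₁ (proj₂ longest)))
      y⊏x : y ⊏ x
      y⊏x = proj₂ (sound (proj₁ (proj₂ longest)))
      below-y : ∀ {s} → ((T s × s ⊏ x) × s ≢ y) ⇔ (T s × s ⊏ y)
      below-y {s} = mk⇔ to λ (Ts , s⊏y) → (Ts , ⊏-trans s⊏y y⊏x) , λ { refl → ⊏-irrefl s⊏y }
        where
        to : (T s × s ⊏ x) × s ≢ y → T s × s ⊏ y
        to ((Ts , s⊏x) , s≢y) with ⊑-total-below (⊏⇒⊑ s⊏x) (⊏⇒⊑ y⊏x)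
        ... | inj₁ s⊑y = Ts , [ (λ s≡y → ⊥-elim (s≢y s≡y)) , id ] (⊑⇒≡⊎⊏ s⊑y)
        ... | inj₂ y⊑s = ⊥-elim ([ (λ y≡s → s≢y (sym y≡s)) , y⊏s⇒⊥ ] (⊑⇒≡⊎⊏ y⊑s))
          where
          y⊏s⇒⊥ : ¬ (y ⊏ s)
          y⊏s⇒⊥ y⊏s =
            <-irrefl refl (<-≤-trans (⊏⇒length< y⊏s) (proj₂ (proj₂ longest) (complete (Ts , s⊏x))))

    level-below-+ : ∀ j {m y} → Level T (j + m) y → Σ (Seq b) λ x → Level T m x × x ⊑ y
    level-below-+ zero ly = _ , ly , ⊑-refl
    level-below-+ (suc j) ly with level-predecessor ly
    ... | z , lz , z⊏y with level-below-+ j lz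
    ...   | x , lx , x⊑z = x , lx , ⊑-trans x⊑z (⊏⇒⊑ z⊏y)

    level-below-≤ : ∀ {m n y} → m ≤ n → Level T n y → Σ (Seq b) λ x → Level T m x × x ⊑ y
    level-below-≤ {m} {n} m≤n ly =
      level-below-+ (n ∸ m) (subst (λ k → Level T k _) (sym (m∸n+n≡m m≤n)) ly)

    level-below-< : ∀ {m n y} → m < n → Level T n y → Σ (Seq b) λ x → Level T m x × x ⊏ y
    level-below-< {n = suc n} (s≤s m≤n) ly with level-predecessor ly
    ... | z , lz , z⊏y with level-below-≤ m≤n lz
    ...   | x , lx , x⊑z = x , lx , ⊑-⊏-trans x⊑z z⊏y

    height⇒level< : ∀ {k n x} → Height T k → Level T n x → n < k
    height⇒level< {k} {n} (_ , ¬level-k) lx with k ≤? n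
    ... | no k≰n = ≰⇒> k≰n
    ... | yes k≤n = let (y , T[k]y , _) = level-below-≤ k≤n lx in ⊥-elim (¬level-k (y , T[k]y))

module StrongSubtrees {b : ℕ} where

  open import Data.Nat using (_<_)
  open import Data.Nat.Induction using (<-wellFounded)
  open import Induction.WellFounded using (Acc; acc)
  open import Data.List using (length)
  open import Data.Product using (Σ; _×_; _,_)
  open import Data.Sum using (inj₁; inj₂)
  open import Data.Empty using (⊥-elim)
  open import Function using (_∘_)
  open import Relation.Nullary using (¬_; yes; no)
  open import Relation.Nullary.Decidable using (decidable-stable; ¬¬-excluded-middle)
  open import Relation.Binary.PropositionalEquality using (_≡_; refl; subst)
  open import Defs
  open Prefix {b}

  -- Membership in S is not decidable, so the immediate successor of s below x is only found
  -- under double negation; StrongSubtree-trans uses it for a decidable goal.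
  ¬¬-immediate-successor-below : ∀ {S : Tree b} {s x} → S x → s ⊏ x →
                                 ¬ ¬ (Σ (Seq b) λ u → ImmSucc S s u × u ⊑ x)
  ¬¬-immediate-successor-below {S} {s} Sx s⊏x = search (<-wellFounded _) Sx s⊏x
    where
    search : ∀ {x} → Acc _<_ (length x) → S x → s ⊏ x → ¬ ¬ (Σ (Seq b) λ u → ImmSucc S s u × u ⊑ x)
    search {x} (acc below) Sx s⊏x k = ¬¬-excluded-middle {A = Σ (Seq b) λ v → S v × s ⊏ v × v ⊏ x} λ where
      (yes (v , Sv , s⊏v , v⊏x)) →
        search (below (⊏⇒length< v⊏x)) Sv s⊏v λ (u , u-imm , u⊑v) → k (u , u-imm , ⊑-trans u⊑v (⊏⇒⊑ v⊏x))
      (no ∄v) → k (x , (Sx , s⊏x , λ v Sv s⊏v v⊏x → ∄v (v , Sv , s⊏v , v⊏x)) , ⊑-refl)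

  immediate-successor-⊑ : ∀ {T : Tree b} {s t u x} → ImmSucc T s t → T u → s ⊏ u → t ⊑ x → u ⊑ x → t ⊑ u
  immediate-successor-⊑ (_ , _ , t-imm) Tu s⊏u t⊑x u⊑x with ⊑-total-below t⊑x u⊑x
  ... | inj₁ t⊑u = t⊑u
  ... | inj₂ u⊑t with ⊑⇒≡⊎⊏ u⊑t
  ...   | inj₁ refl = ⊑-refl
  ...   | inj₂ u⊏t = ⊥-elim (t-imm _ Tu s⊏u u⊏t)

  StrongSubtree-trans : ∀ {T S S′ : Tree b} → StrongSubtree T S → StrongSubtree S S′ → StrongSubtree T S′
  StrongSubtree-trans {T} {S} {S′} (S⊆T , _ , _ , levelsS , successorsS)
                                   (S′⊆S , rooted , balanced , levelsS′ , successorsS′) =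
    (λ s → S⊆T s ∘ S′⊆S s) , rooted , balanced , levels , successors
    where
    levels : ∀ n → Σ ℕ λ m → ∀ s → Level S′ n s → Level T m s
    levels n = let (m , S′n⊆Sm) = levelsS′ n ; (l , Sm⊆Tl) = levelsS m in l , λ s → Sm⊆Tl s ∘ S′n⊆Sm s

    maximal-restrict : ∀ {s} → S′ s → MaximalIn S s → MaximalIn S′ s
    maximal-restrict S′s (_ , max) = S′s , λ u S′u → max u (S′⊆S u S′u)

    successors : ∀ s → S′ s → ¬ MaximalIn S′ s → ∀ t → ImmSucc T s t →
                 Σ (Seq b) λ s′ → (ImmSucc S′ s s′ × t ⊑ s′) × (∀ s″ → ImmSucc S′ s s″ × t ⊑ s″ → s″ ≡ s′)
    successors s S′s ¬max t t-imm with successorsS s (S′⊆S s S′s) (¬max ∘ maximal-restrict S′s) t t-imm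
    ... | s₁ , (s₁-imm , t⊑s₁) , s₁-unique with successorsS′ s S′s ¬max s₁ s₁-imm
    ...   | s₂ , (s₂-imm , s₁⊑s₂) , s₂-unique =
      s₂ , (s₂-imm , ⊑-trans t⊑s₁ s₁⊑s₂) , λ s″ (s″-imm , t⊑s″) → s₂-unique s″ (s″-imm , s₁⊑ s″-imm t⊑s″)
      where
      s₁⊑ : ∀ {s″} → ImmSucc S′ s s″ → t ⊑ s″ → s₁ ⊑ s″
      s₁⊑ {s″} (S′s″ , s⊏s″ , _) t⊑s″ = decidable-stable (s₁ ⊑? s″) λ s₁⋢s″ →
        ¬¬-immediate-successor-below (S′⊆S s″ S′s″) s⊏s″ λ (u , u-imm@(Su , s⊏u , _) , u⊑s″) →
          s₁⋢s″ (subst (_⊑ s″) (s₁-unique u (u-imm , immediate-successor-⊑ t-imm (S⊆T u Su) s⊏u t⊑s″ u⊑s″)) u⊑s″)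

  level-inclusion : ∀ {T S : Tree b} → StrongSubtree T S → ∀ n → Σ ℕ λ m → ∀ s → Level S n s → Level T m s
  level-inclusion (_ , _ , _ , levels , _) = levels

module Tuples where

  open import Level using (Level)
  open import Data.Nat using (ℕ)
  open import Data.Fin using (zero; suc)
  open import Data.Vec using (Vec; []; _∷_; _∷ʳ_)
  open import Data.Vec.Relation.Unary.All using (All; []; _∷_)
  open import Data.Product using (Σ; _×_; _,_; proj₁; proj₂)
  open import Relation.Nullary using (yes; no)
  open import Relation.Binary.Definitions using (DecidableEquality)
  open import Relation.Binary.PropositionalEquality using (_≡_; refl; cong; subst)
  open import Defs using (Seq; Tuple; get)

  private variable
    a a′ ℓ : Level

  module _ {A : ℕ → Set a} where

    snoc : ∀ {d} {bs : Vec ℕ d} {c} → All A bs → A c → All A (bs ∷ʳ c)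
    snoc [] x = x ∷ []
    snoc (y ∷ ys) x = y ∷ snoc ys x

    init : ∀ {d} {bs : Vec ℕ d} {c} → All A (bs ∷ʳ c) → All A bs
    init {bs = []} _ = []
    init {bs = _ ∷ _} (y ∷ ys) = y ∷ init ys

    last : ∀ {d} {bs : Vec ℕ d} {c} → All A (bs ∷ʳ c) → A c
    last {bs = []} (x ∷ []) = x
    last {bs = _ ∷ _} (_ ∷ ys) = last ys

    snoc-init-last : ∀ {d} {bs : Vec ℕ d} {c} → (xs : All A (bs ∷ʳ c)) → snoc (init xs) (last xs) ≡ xs
    snoc-init-last {bs = []} (x ∷ []) = refl
    snoc-init-last {bs = _ ∷ _} (y ∷ ys) = cong (y ∷_) (snoc-init-last ys)

    init-snoc : ∀ {d} {bs : Vec ℕ d} {c} → (xs : All A bs) (x : A c) → init (snoc xs x) ≡ xs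
    init-snoc [] x = refl
    init-snoc (y ∷ ys) x = cong (y ∷_) (init-snoc ys x)

    last-snoc : ∀ {d} {bs : Vec ℕ d} {c} → (xs : All A bs) (x : A c) → last (snoc xs x) ≡ x
    last-snoc [] x = refl
    last-snoc (_ ∷ ys) x = last-snoc ys x

    snoc-elim : ∀ {d} {bs : Vec ℕ d} {c} {P : All A (bs ∷ʳ c) → Set ℓ} →
                (∀ xs x → P (snoc xs x)) → ∀ xs → P xs
    snoc-elim {P = P} P-snoc xs = subst P (snoc-init-last xs) (P-snoc (init xs) (last xs))

  module _ {A : ℕ → Set a} {B : ℕ → Set a′} (R : ∀ {c} → A c → B c → Set ℓ) where

    snoc-pointwise⁻ : ∀ {d} {bs : Vec ℕ d} {c} → (X : All A bs) (x : A c) (Y : All B bs) (y : B c) →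
                      (∀ i → R (get (snoc X x) i) (get (snoc Y y) i)) →
                      (∀ i → R (get X i) (get Y i)) × R x y
    snoc-pointwise⁻ [] x [] y R⁺ = (λ ()) , R⁺ zero
    snoc-pointwise⁻ (_ ∷ X) x (_ ∷ Y) y R⁺ =
      let (R-init , R-last) = snoc-pointwise⁻ X x Y y (λ i → R⁺ (suc i)) in
      (λ { zero → R⁺ zero ; (suc i) → R-init i }) , R-last

    snoc-pointwise⁺ : ∀ {d} {bs : Vec ℕ d} {c} → (X : All A bs) (x : A c) (Y : All B bs) (y : B c) →
                      (∀ i → R (get X i) (get Y i)) → R x y →
                      ∀ i → R (get (snoc X x) i) (get (snoc Y y) i)
    snoc-pointwise⁺ [] x [] y _ Rxy zero = Rxy
    snoc-pointwise⁺ (_ ∷ _) x (_ ∷ _) y R-init _ zero = R-init zero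
    snoc-pointwise⁺ (_ ∷ X) x (_ ∷ Y) y R-init Rxy (suc i) = snoc-pointwise⁺ X x Y y (λ j → R-init (suc j)) Rxy i

  pointwise-choice : ∀ {d} {bs : Vec ℕ d} {A : ℕ → Set a} (X : All A bs) (R : ∀ {c} → A c → Seq c → Set ℓ) →
                     (∀ i → Σ (Seq _) (R (get X i))) → Σ (Tuple bs) λ t → ∀ i → R (get X i) (get t i)
  pointwise-choice [] R _ = [] , λ ()
  pointwise-choice (_ ∷ X) R choice =
    let (t , Rt) = pointwise-choice X R (λ i → choice (suc i)) in
    proj₁ (choice zero) ∷ t , λ { zero → proj₂ (choice zero) ; (suc i) → Rt i }

  _≟_ : ∀ {d} {bs : Vec ℕ d} → DecidableEquality (Tuple bs)
  [] ≟ [] = yes refl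
  (x ∷ xs) ≟ (y ∷ ys) with x Prefix.≟ y | xs ≟ ys
  ... | yes refl | yes refl = yes refl
  ... | no x≢y   | _        = no λ { refl → x≢y refl }
  ... | yes _    | no xs≢ys = no λ { refl → xs≢ys refl }

module VectorTrees where

  open import Data.Nat using (ℕ; _<_)
  open import Data.Vec using (Vec)
  open import Data.Product using (Σ; _×_; _,_; proj₁; proj₂)
  open import Relation.Binary.PropositionalEquality using (_≡_; sym; trans; subst)
  open import Defs
  open Tuples
  open Levels using (level-unique; height⇒level<)
  open StrongSubtrees using (level-inclusion)

  module _ {d} {bs : Vec ℕ d} where

    -- Level n of each S i lies in some level of T i; these agree because a level-n tuple of S lies in a
    -- single level of T.
    common-level-set : ∀ (T S : VTree bs) k → (∀ i → StrongSubtree (get T i) (get S i) × Height (get S i) k) →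
                       (∀ n → n < k → ∀ t → LevelProd S n t → Σ ℕ λ m → LevelProd T m t) →
                       CommonLevelSet T S
    common-level-set T S k strong S⊆⊗T i j m (n , (x , S[n]x) , S[n]⊆T[m])
      with height⇒level< (proj₂ (strong i)) S[n]x
    ... | n<k with pointwise-choice S (λ X s → Level X n s) (λ i′ → proj₁ (proj₂ (strong i′)) n n<k)
    ...   | t , S[n]t with S⊆⊗T n n<k t S[n]t | level-inclusion (proj₁ (strong j)) n
    ...     | a , T[a]t | l , S[n]⊆T[l] =
      n , (get t j , S[n]t j) ,
      λ s S[n]s → subst (λ l′ → Level (get T j) l′ s) (trans l≡a (sym m≡a)) (S[n]⊆T[l] s S[n]s)
      where
      m≡a : m ≡ a
      m≡a = level-unique (S[n]⊆T[m] (get t i) (S[n]t i)) (T[a]t i)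
      l≡a : l ≡ a
      l≡a = level-unique (S[n]⊆T[l] (get t j) (S[n]t j)) (T[a]t j)

  module _ {d} {bs : Vec ℕ d} {b} (T′ : VTree bs) (W : Tree b) {n : ℕ} where

    level-product-snoc⁻ : ∀ t w → LevelProd (snoc T′ W) n (snoc t w) → LevelProd T′ n t × Level W n w
    level-product-snoc⁻ t w = snoc-pointwise⁻ (λ X x → Level X n x) T′ W t w

    level-product-snoc⁺ : ∀ t w → LevelProd T′ n t → Level W n w → LevelProd (snoc T′ W) n (snoc t w)
    level-product-snoc⁺ t w = snoc-pointwise⁺ (λ X x → Level X n x) T′ W t w

module Fractions where

  open import Data.Nat as ℕ using (ℕ; suc)
  import Data.Nat.Properties as ℕ
  open import Data.Integer as ℤ using (+_; +≤+; +<+)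
  import Data.Integer.Properties as ℤ
  open import Data.Rational as ℚ using (_/_; toℚᵘ)
  import Data.Rational.Properties as ℚ
  open import Data.Rational.Unnormalised as ℚᵘ using (mkℚᵘ; *≡*; *≤*; *<*)
  import Data.Rational.Unnormalised.Properties as ℚᵘ
  open import Relation.Binary.PropositionalEquality using (_≡_; sym; cong; cong₂; subst₂; module ≡-Reasoning)

  private
    toℚᵘ-/ : ∀ a n → toℚᵘ (+ a / suc n) ℚᵘ.≃ mkℚᵘ (+ a) n
    toℚᵘ-/ a n = ℚ.toℚᵘ-fromℚᵘ (mkℚᵘ (+ a) n)

    +-* : ∀ a b → + a ℤ.* + b ≡ + (a ℕ.* b)
    +-* a b = sym (ℤ.pos-* a b)

    mkℚᵘ-≤⁺ : ∀ a n b m → a ℕ.* suc m ℕ.≤ b ℕ.* suc n → mkℚᵘ (+ a) n ℚᵘ.≤ mkℚᵘ (+ b) m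
    mkℚᵘ-≤⁺ a n b m h = *≤* (subst₂ ℤ._≤_ (sym (+-* a (suc m))) (sym (+-* b (suc n))) (+≤+ h))

    mkℚᵘ-≤⁻ : ∀ a n b m → mkℚᵘ (+ a) n ℚᵘ.≤ mkℚᵘ (+ b) m → a ℕ.* suc m ℕ.≤ b ℕ.* suc n
    mkℚᵘ-≤⁻ a n b m (*≤* h) = ℤ.drop‿+≤+ (subst₂ ℤ._≤_ (+-* a (suc m)) (+-* b (suc n)) h)

    mkℚᵘ-<⁺ : ∀ a n b m → a ℕ.* suc m ℕ.< b ℕ.* suc n → mkℚᵘ (+ a) n ℚᵘ.< mkℚᵘ (+ b) m
    mkℚᵘ-<⁺ a n b m h = *<* (subst₂ ℤ._<_ (sym (+-* a (suc m))) (sym (+-* b (suc n))) (+<+ h))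

    mkℚᵘ-<⁻ : ∀ a n b m → mkℚᵘ (+ a) n ℚᵘ.< mkℚᵘ (+ b) m → a ℕ.* suc m ℕ.< b ℕ.* suc n
    mkℚᵘ-<⁻ a n b m (*<* h) = ℤ.drop‿+<+ (subst₂ ℤ._<_ (+-* a (suc m)) (+-* b (suc n)) h)

  /-≤⁺ : ∀ a n b m → a ℕ.* suc m ℕ.≤ b ℕ.* suc n → + a / suc n ℚ.≤ + b / suc m
  /-≤⁺ a n b m h = ℚ.toℚᵘ-cancel-≤
    (ℚᵘ.≤-respˡ-≃ (ℚᵘ.≃-sym (toℚᵘ-/ a n)) (ℚᵘ.≤-respʳ-≃ (ℚᵘ.≃-sym (toℚᵘ-/ b m)) (mkℚᵘ-≤⁺ a n b m h)))

  /-≤⁻ : ∀ a n b m → + a / suc n ℚ.≤ + b / suc m → a ℕ.* suc m ℕ.≤ b ℕ.* suc n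
  /-≤⁻ a n b m h = mkℚᵘ-≤⁻ a n b m
    (ℚᵘ.≤-respˡ-≃ (toℚᵘ-/ a n) (ℚᵘ.≤-respʳ-≃ (toℚᵘ-/ b m) (ℚ.toℚᵘ-mono-≤ h)))

  /-<⁺ : ∀ a n b m → a ℕ.* suc m ℕ.< b ℕ.* suc n → + a / suc n ℚ.< + b / suc m
  /-<⁺ a n b m h = ℚ.toℚᵘ-cancel-<
    (ℚᵘ.<-respˡ-≃ (ℚᵘ.≃-sym (toℚᵘ-/ a n)) (ℚᵘ.<-respʳ-≃ (ℚᵘ.≃-sym (toℚᵘ-/ b m)) (mkℚᵘ-<⁺ a n b m h)))

  /-<⁻ : ∀ a n b m → + a / suc n ℚ.< + b / suc m → a ℕ.* suc m ℕ.< b ℕ.* suc n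
  /-<⁻ a n b m h = mkℚᵘ-<⁻ a n b m
    (ℚᵘ.<-respˡ-≃ (toℚᵘ-/ a n) (ℚᵘ.<-respʳ-≃ (toℚᵘ-/ b m) (ℚ.toℚᵘ-mono-< h)))

  /-*-/1 : ∀ a n x → (+ a / suc n) ℚ.* (+ x / 1) ≡ + (a ℕ.* x) / suc n
  /-*-/1 a n x = ℚ.toℚᵘ-injective (ℚᵘ.≃-trans (ℚ.toℚᵘ-homo-* (+ a / suc n) (+ x / 1))
    (ℚᵘ.≃-trans (ℚᵘ.*-cong (toℚᵘ-/ a n) (toℚᵘ-/ x 0)) (ℚᵘ.≃-trans product (ℚᵘ.≃-sym (toℚᵘ-/ (a ℕ.* x) n)))))
    where
    open ≡-Reasoning
    product : mkℚᵘ (+ a) n ℚᵘ.* mkℚᵘ (+ x) 0 ℚᵘ.≃ mkℚᵘ (+ (a ℕ.* x)) n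
    product = *≡* (begin
      + a ℤ.* + x ℤ.* + suc n          ≡⟨ cong (ℤ._* + suc n) (+-* a x) ⟩
      + (a ℕ.* x) ℤ.* + suc n          ≡⟨ cong (λ k → + (a ℕ.* x) ℤ.* + suc k) (sym (ℕ.*-identityʳ n)) ⟩
      + (a ℕ.* x) ℤ.* + suc (n ℕ.* 1)  ∎)

  /1-+-/1 : ∀ y z → (+ y / 1) ℚ.+ (+ z / 1) ≡ + (y ℕ.+ z) / 1
  /1-+-/1 y z = ℚ.toℚᵘ-injective (ℚᵘ.≃-trans (ℚ.toℚᵘ-homo-+ (+ y / 1) (+ z / 1))
    (ℚᵘ.≃-trans (ℚᵘ.+-cong (toℚᵘ-/ y 0) (toℚᵘ-/ z 0)) (ℚᵘ.≃-trans sum (ℚᵘ.≃-sym (toℚᵘ-/ (y ℕ.+ z) 0)))))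
    where
    open ≡-Reasoning
    sum : mkℚᵘ (+ y) 0 ℚᵘ.+ mkℚᵘ (+ z) 0 ℚᵘ.≃ mkℚᵘ (+ (y ℕ.+ z)) 0
    sum = *≡* (begin
      (+ y ℤ.* + 1 ℤ.+ + z ℤ.* + 1) ℤ.* + 1 ≡⟨ ℤ.*-identityʳ _ ⟩
      + y ℤ.* + 1 ℤ.+ + z ℤ.* + 1           ≡⟨ cong₂ ℤ._+_ (ℤ.*-identityʳ (+ y)) (ℤ.*-identityʳ (+ z)) ⟩
      + y ℤ.+ + z                           ≡⟨ sym (ℤ.pos-+ y z) ⟩
      + (y ℕ.+ z)                           ≡⟨ sym (ℤ.*-identityʳ _) ⟩
      + (y ℕ.+ z) ℤ.* + 1                   ∎)

module Approximation (ε : Real) (ε>0 : Real.L ε 0ℚ) (ε<1 : ∀ q → Real.L ε q → q ℚ.< 1ℚ) where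

  open import Data.Rational using (_/_)
  open import Defs using (_·_≤ᶜ_; half)
  open import Data.Nat as ℕ using (ℕ; zero; suc; _+_; _*_; _∸_; _≤_; _<_; s≤s; z≤n)
  import Data.Nat.Properties as ℕ
  open import Data.Nat.Tactic.RingSolver using (solve-∀)
  open import Data.Integer as ℤ using (+_; -[1+_])
  import Data.Rational.Properties as ℚ
  open import Data.Product using (Σ; _×_; _,_; proj₁; proj₂)
  open import Data.Sum using (inj₁; inj₂)
  open import Data.Empty using (⊥-elim)
  open import Relation.Nullary using (yes; no)
  open import Relation.Binary using (tri<; tri≈; tri>)
  open import Relation.Binary.PropositionalEquality using (_≡_; refl; sym; trans; cong; subst; subst₂)
  open Fractions

  open Real ε

  L-downward : ∀ {p q} → L p → q ℚ.≤ p → L q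
  L-downward {p} {q} Lp q≤p with ℚ.<-cmp q p
  ... | tri< q<p _ _ = proj₂ (roundedL q) (p , q<p , Lp)
  ... | tri≈ _ refl _ = Lp
  ... | tri> _ _ p<q = ⊥-elim (ℚ.<-irrefl refl (ℚ.<-≤-trans p<q q≤p))

  L<U : ∀ {p r} → L p → U r → p ℚ.< r
  L<U {p} {r} Lp Ur with r ℚ.≤? p
  ... | yes r≤p = ⊥-elim (disjoint r (L-downward Lp r≤p , Ur))
  ... | no r≰p = ℚ.≰⇒> r≰p

  -- (4 + A)/N < ε < (8 + A)/N with N = 4 + A + B; `narrow` makes the window 4/N small compared with ε².
  record Approximant : Set where
    field
      A B    : ℕ
      lower  : L (+ (4 + A) / (4 + A + B))
      upper  : U (+ (8 + A) / (4 + A + B))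
      A≥1    : 1 ≤ A
      narrow : 16 * B ≤ A * A

  unit-fraction-below : Σ ℕ λ q → L (+ 1 / suc q)
  unit-fraction-below = let (r , 0<r , Lr) = proj₁ (roundedL 0ℚ) ε>0 in below r 0<r Lr
    where
    below : ∀ r → 0ℚ ℚ.< r → L r → Σ ℕ λ q → L (+ 1 / suc q)
    below (ℚ.mkℚ (+ zero) q _) (ℚ.*<* (ℤ.+<+ ())) _
    below (ℚ.mkℚ -[1+ _ ] q _) (ℚ.*<* ()) _
    below r@(ℚ.mkℚ (+ suc k) q _) _ Lr = q , L-downward Lr
      (subst (+ 1 / suc q ℚ.≤_) (ℚ.↥p/↧p≡p r) (/-≤⁺ 1 q (suc k) q (ℕ.*-monoˡ-≤ (suc q) {1} {suc k} (s≤s z≤n))))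

  module _ (n : ℕ) where

    numerator<denominator : ∀ {g} → L (+ g / suc n) → g < suc n
    numerator<denominator {g} Lg =
      subst₂ _<_ (ℕ.*-identityʳ g) (ℕ.+-identityʳ (suc n)) (/-<⁻ g n 1 0 (ε<1 _ Lg))

    fuel-step : ∀ k g → suc k + g ≤ k + (2 + g)
    fuel-step k g = subst (suc k + g ≤_) (sym (ℕ.+-suc k (suc g))) (s≤s (ℕ.+-monoʳ-≤ k (ℕ.n≤1+n g)))

    -- Locatedness at (2 + g)/N < (4 + g)/N either stops the scan or lets it climb by 2/N;
    -- since L lies below 1, the fuel k never runs out.
    scan : ∀ k g → L (+ g / suc n) → suc n ≤ k + g →
           Σ ℕ λ g′ → g ≤ g′ × L (+ g′ / suc n) × U (+ (4 + g′) / suc n)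
    scan zero g Lg N≤g = ⊥-elim (ℕ.<-irrefl refl (ℕ.<-≤-trans (numerator<denominator Lg) N≤g))
    scan (suc k) g Lg N≤k+g with located (+ (2 + g) / suc n) (+ (4 + g) / suc n)
      (/-<⁺ (2 + g) n (4 + g) n (ℕ.*-monoˡ-< (suc n) {2 + g} {4 + g} (ℕ.+-monoˡ-< g (s≤s (s≤s (s≤s z≤n))))))
    ... | inj₂ U[4+g] = g , ℕ.≤-refl , Lg , U[4+g]
    ... | inj₁ L[2+g] with scan k (2 + g) L[2+g] (ℕ.≤-trans N≤k+g (fuel-step k g))
    ...   | g′ , 2+g≤g′ , Lg′ , Ug′ = g′ , ℕ.≤-trans (ℕ.m≤n+m g 2) 2+g≤g′ , Lg′ , Ug′

  private
    expand-N : ∀ A B → 16 * (4 + A + B) ≡ 16 * (4 + A) + 16 * B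
    expand-N = solve-∀
    expand-square : ∀ A → (8 + A) * (8 + A) ≡ 16 * (4 + A) + A * A
    expand-square = solve-∀
    square-16Q : ∀ Q → 16 * (16 * Q * Q) ≡ (16 * Q) * (16 * Q)
    square-16Q = solve-∀

  -- Scanning from 16Q/N = 1/Q ∈ L with N = 16Q² keeps g ≥ 16Q, so (4 + g)² ≥ 16N.
  approximant : Approximant
  approximant with unit-fraction-below
  ... | q , L[1/Q] = window (scan n (suc n) (16 * Q) L[16Q/N] (ℕ.m≤m+n (suc n) (16 * Q)))
    where
    Q n : ℕ
    Q = suc q
    n = ℕ.pred (16 * Q * Q)

    L[16Q/N] : L (+ (16 * Q) / suc n)
    L[16Q/N] = L-downward L[1/Q] (/-≤⁺ (16 * Q) n 1 q (ℕ.≤-reflexive (sym (ℕ.*-identityˡ _))))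

    window : (Σ ℕ λ g → 16 * Q ≤ g × L (+ g / suc n) × U (+ (4 + g) / suc n)) → Approximant
    window (g , 16Q≤g , Lg , Ug) = record
      { A = A ; B = B
      ; lower  = subst (λ m → L (+ m / suc (3 + A + B))) (sym 4+A≡g)
                   (subst (λ m → L (+ g / suc m)) (sym 3+A+B≡n) Lg)
      ; upper  = subst (λ m → U (+ (4 + m) / suc (3 + A + B))) (sym 4+A≡g)
                   (subst (λ m → U (+ (4 + g) / suc m)) (sym 3+A+B≡n) Ug)
      ; A≥1    = ℕ.+-cancelˡ-≤ 4 1 A (subst (5 ≤_) (sym 4+A≡g) 4<g)
      ; narrow = ℕ.+-cancelˡ-≤ (16 * (4 + A)) (16 * B) (A * A)
                   (subst₂ _≤_ (expand-N A B) (expand-square A) 16N≤[8+A]²)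
      }
      where
      4<g : 4 < g
      4<g = ℕ.<-≤-trans (s≤s (s≤s (s≤s (s≤s (s≤s z≤n))))) (ℕ.≤-trans (ℕ.m≤m*n 16 Q) 16Q≤g)
      A B : ℕ
      A = g ∸ 4
      B = suc n ∸ g
      4+A≡g : 4 + A ≡ g
      4+A≡g = ℕ.m+[n∸m]≡n (ℕ.<⇒≤ 4<g)
      3+A+B≡n : 3 + A + B ≡ n
      3+A+B≡n = ℕ.suc-injective (trans (cong (_+ B) 4+A≡g) (ℕ.m+[n∸m]≡n {g} (ℕ.<⇒≤ (numerator<denominator n Lg))))
      16Q≤4+g : 16 * Q ≤ 4 + g
      16Q≤4+g = ℕ.≤-trans 16Q≤g (ℕ.m≤n+m g 4)
      16N≤[8+A]² : 16 * (4 + A + B) ≤ (8 + A) * (8 + A)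
      16N≤[8+A]² = subst₂ (λ x y → 16 * x ≤ (4 + y) * (4 + y)) (cong suc (sym 3+A+B≡n)) (sym 4+A≡g)
        (ℕ.≤-trans (ℕ.≤-reflexive (square-16Q Q)) (ℕ.*-mono-≤ 16Q≤4+g 16Q≤4+g))

  module _ (approx : Approximant) where
    open Approximant approx

    ≤ᶜ⇒lower-bound : ∀ {t c} → L · t ≤ᶜ c → (4 + A) * t ≤ c * (4 + A + B)
    ≤ᶜ⇒lower-bound {t} {c} ε·t≤c = subst (_≤ c * (4 + A + B)) (ℕ.*-identityʳ _)
      (/-≤⁻ ((4 + A) * t) (3 + A + B) c 0
        (subst (ℚ._≤ + c / 1) (/-*-/1 (4 + A) (3 + A + B) t) (ε·t≤c _ lower)))

    upper-bound⇒half-≤ᶜ : ∀ {x y} → (8 + A) * x ≤ (y + y) * (4 + A + B) → half L · x ≤ᶜ y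
    upper-bound⇒half-≤ᶜ {x} {y} bound q L[2q] with q ℚ.* (+ x / 1) ℚ.≤? + y / 1
    ... | yes qx≤y = qx≤y
    ... | no qx≰y = ⊥-elim (ℚ.<-irrefl refl (ℚ.<-≤-trans 2y<2qx (ℚ.≤-trans 2qx≤[8+A]x/N [8+A]x/N≤2y)))
      where
      instance
        x≥0 : ℚ.NonNegative (+ x / 1)
        x≥0 = ℚ.normalize-nonNeg x 1
      qx : ℚ.ℚ
      qx = q ℚ.* (+ x / 1)
      2y<2qx : + (y + y) / 1 ℚ.< qx ℚ.+ qx
      2y<2qx = subst (ℚ._< qx ℚ.+ qx) (/1-+-/1 y y) (ℚ.+-mono-< (ℚ.≰⇒> qx≰y) (ℚ.≰⇒> qx≰y))
      2qx≤[8+A]x/N : qx ℚ.+ qx ℚ.≤ + ((8 + A) * x) / (4 + A + B)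
      2qx≤[8+A]x/N = subst₂ ℚ._≤_ (ℚ.*-distribʳ-+ (+ x / 1) q q) (/-*-/1 (8 + A) (3 + A + B) x)
        (ℚ.*-monoʳ-≤-nonNeg (+ x / 1) (ℚ.<⇒≤ (L<U L[2q] upper)))
      [8+A]x/N≤2y : + ((8 + A) * x) / (4 + A + B) ℚ.≤ + (y + y) / 1
      [8+A]x/N≤2y = /-≤⁺ ((8 + A) * x) (3 + A + B) (y + y) 0
        (subst (_≤ (y + y) * (4 + A + B)) (sym (ℕ.*-identityʳ _)) bound)

module Averaging where

  open import Data.Nat using (ℕ; suc; _+_; _*_; _≤_; _≤?_; z≤n)
  open import Data.Nat.Properties
  open import Data.Nat.Tactic.RingSolver using (solve-∀)
  open import Data.Nat.ListAction using (sum)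
  open import Data.List using ([]; _∷_; map; length; filter)
  open import Data.List.Properties using (filter-accept; filter-reject)
  open import Relation.Nullary using (yes; no)
  open import Relation.Unary using (Decidable)
  open import Relation.Unary.Properties using (∁?)
  open import Relation.Binary.PropositionalEquality using (_≡_; refl; sym; trans; cong; subst₂)

  -- e heavy and f light fibres, N = 4 + A + B: the heavy fraction is pushed above (8 + A)/2N, and
  -- after clearing denominators this is where 16B ≤ A² is needed.
  averaging : ∀ A B e f → 1 ≤ A → 16 * B ≤ A * A →
              2 * (4 + A) * (e + f) ≤ 2 * (4 + A + B) * e + (8 + A) * f →
              (8 + A) * (e + f) ≤ (e + e) * (4 + A + B)
  averaging A@(suc _) B e f _ 16B≤A² weighted = begin
    (8 + A) * (e + f)           ≡⟨ *-distribˡ-+ (8 + A) e f ⟩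
    (8 + A) * e + (8 + A) * f   ≤⟨ +-monoʳ-≤ ((8 + A) * e) [8+A]f≤[A+2B]e ⟩
    (8 + A) * e + (A + 2 * B) * e ≡⟨ regroup A B e ⟩
    (e + e) * (4 + A + B)       ∎
    where
    open ≤-Reasoning
    split-lhs : ∀ A e f → 2 * (4 + A) * (e + f) ≡ 2 * (4 + A) * e + (A * f + (8 + A) * f)
    split-lhs = solve-∀
    split-rhs : ∀ A B e f → 2 * (4 + A + B) * e + (8 + A) * f ≡ 2 * (4 + A) * e + (2 * B * e + (8 + A) * f)
    split-rhs = solve-∀
    commute : ∀ A f → A * ((8 + A) * f) ≡ (8 + A) * (A * f)
    commute = solve-∀
    scale : ∀ A B e → A * (2 * B * e) + (A * A) * e ≡ A * ((A + 2 * B) * e)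
    scale = solve-∀
    scale′ : ∀ A B e → (8 + A) * (2 * B * e) ≡ A * (2 * B * e) + (16 * B) * e
    scale′ = solve-∀
    regroup : ∀ A B e → (8 + A) * e + (A + 2 * B) * e ≡ (e + e) * (4 + A + B)
    regroup = solve-∀

    Af≤2Be : A * f ≤ 2 * B * e
    Af≤2Be = +-cancelʳ-≤ ((8 + A) * f) (A * f) (2 * B * e)
               (+-cancelˡ-≤ (2 * (4 + A) * e) _ _ (subst₂ _≤_ (split-lhs A e f) (split-rhs A B e f) weighted))

    [8+A]f≤[A+2B]e : (8 + A) * f ≤ (A + 2 * B) * e
    [8+A]f≤[A+2B]e = *-cancelˡ-≤ A (begin
      A * ((8 + A) * f)               ≡⟨ commute A f ⟩
      (8 + A) * (A * f)               ≤⟨ *-monoʳ-≤ (8 + A) Af≤2Be ⟩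
      (8 + A) * (2 * B * e)           ≡⟨ scale′ A B e ⟩
      A * (2 * B * e) + (16 * B) * e  ≤⟨ +-monoʳ-≤ (A * (2 * B * e)) (*-monoˡ-≤ e 16B≤A²) ⟩
      A * (2 * B * e) + (A * A) * e   ≡⟨ scale A B e ⟩
      A * ((A + 2 * B) * e)           ∎)

  averaging-fibres : ∀ A B e f m c → 1 ≤ A → 16 * B ≤ A * A → 1 ≤ m →
                     (4 + A) * ((e + f) * m) ≤ c * (4 + A + B) →
                     (c + c) * (4 + A + B) ≤ ((m + m) * (4 + A + B)) * e + ((8 + A) * m) * f →
                     (8 + A) * (e + f) ≤ (e + e) * (4 + A + B)
  averaging-fibres A B e f m@(suc _) c A≥1 16B≤A² _ lower weighted =
    averaging A B e f A≥1 16B≤A² (*-cancelʳ-≤ _ _ m (begin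
      2 * (4 + A) * (e + f) * m                                ≡⟨ double A e f m ⟩
      (4 + A) * ((e + f) * m) + (4 + A) * ((e + f) * m)        ≤⟨ +-mono-≤ lower lower ⟩
      c * (4 + A + B) + c * (4 + A + B)                        ≡⟨ sym (*-distribʳ-+ (4 + A + B) c c) ⟩
      (c + c) * (4 + A + B)                                    ≤⟨ weighted ⟩
      ((m + m) * (4 + A + B)) * e + ((8 + A) * m) * f          ≡⟨ factor A B m e f ⟩
      (2 * (4 + A + B) * e + (8 + A) * f) * m                  ∎))
    where
    open ≤-Reasoning
    double : ∀ A e f m → 2 * (4 + A) * (e + f) * m ≡ (4 + A) * ((e + f) * m) + (4 + A) * ((e + f) * m)
    double = solve-∀
    factor : ∀ A B m e f → ((m + m) * (4 + A + B)) * e + ((8 + A) * m) * f ≡ (2 * (4 + A + B) * e + (8 + A) * f) * m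
    factor = solve-∀

  private
    split : ∀ a s n → ((a + s) + (a + s)) * n ≡ (a + a) * n + (s + s) * n
    split = solve-∀
    heavy-step : ∀ p h q l → p * suc h + q * l ≡ p + (p * h + q * l)
    heavy-step = solve-∀
    light-step : ∀ p h q l → p * h + q * suc l ≡ q + (p * h + q * l)
    light-step = solve-∀

  module _ {X : Set} (v : X → ℕ) (m N G : ℕ) where

    heavy? : Decidable (λ x → G * m ≤ (v x + v x) * N)
    heavy? x = G * m ≤? (v x + v x) * N

    length-heavy+light : ∀ xs → length (filter heavy? xs) + length (filter (∁? heavy?) xs) ≡ length xs
    length-heavy+light [] = refl
    length-heavy+light (x ∷ xs) with heavy? x
    ... | yes h rewrite filter-accept heavy? {x} {xs} h | filter-reject (∁? heavy?) {x} {xs} (λ ¬h → ¬h h) =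
      cong suc (length-heavy+light xs)
    ... | no ¬h rewrite filter-reject heavy? {x} {xs} ¬h | filter-accept (∁? heavy?) {x} {xs} ¬h =
      trans (+-suc _ _) (cong suc (length-heavy+light xs))

    weighted-sum-bound : ∀ xs → (∀ x → v x ≤ m) →
      (sum (map v xs) + sum (map v xs)) * N ≤
        ((m + m) * N) * length (filter heavy? xs) + (G * m) * length (filter (∁? heavy?) xs)
    weighted-sum-bound [] _ = z≤n
    weighted-sum-bound (x ∷ xs) v≤m with heavy? x
    ... | yes h rewrite filter-accept heavy? {x} {xs} h | filter-reject (∁? heavy?) {x} {xs} (λ ¬h → ¬h h) =
      subst₂ _≤_ (sym (split (v x) (sum (map v xs)) N)) (sym (heavy-step ((m + m) * N) _ (G * m) _))
        (+-mono-≤ (*-monoˡ-≤ N (+-mono-≤ (v≤m x) (v≤m x))) (weighted-sum-bound xs v≤m))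
    ... | no ¬h rewrite filter-reject heavy? {x} {xs} ¬h | filter-accept (∁? heavy?) {x} {xs} ¬h =
      subst₂ _≤_ (sym (split (v x) (sum (map v xs)) N)) (sym (light-step ((m + m) * N) _ (G * m) _))
        (+-mono-≤ (<⇒≤ (≰⇒> ¬h)) (weighted-sum-bound xs v≤m))

module Pairs {A B C : Set} (pair : A → B → C) (fst : C → A) (snd : C → B)
             (fst-pair : ∀ a b → fst (pair a b) ≡ a) (snd-pair : ∀ a b → snd (pair a b) ≡ b)
             (pair-fst-snd : ∀ u → pair (fst u) (snd u) ≡ u) where

  open import Data.Nat using (_+_; _*_)
  open import Data.List using (List; []; _∷_; _++_; map; length)
  open import Data.Nat.ListAction using (sum)
  open import Data.List.Properties using (length-++; length-map)
  open import Data.List.Membership.Propositional using (_∈_)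
  open import Data.List.Membership.Propositional.Properties using (∈-++⁺ˡ; ∈-++⁺ʳ; ∈-++⁻; ∈-map⁺; ∈-map⁻)
  open import Data.List.Relation.Unary.Any using (here; there)
  import Data.List.Relation.Unary.All as All
  open import Data.List.Relation.Unary.AllPairs using ([]; _∷_)
  open import Data.List.Relation.Unary.Unique.Propositional using (Unique)
  import Data.List.Relation.Unary.Unique.Propositional.Properties as Unique
  open import Data.Product using (_×_; _,_; proj₁)
  open import Data.Sum using (inj₁; inj₂)
  open import Relation.Nullary using (¬_)
  open import Function using (_∘_)
  open import Function.Bundles using (_⇔_; mk⇔; Equivalence)
  open import Relation.Binary.PropositionalEquality using (refl; sym; trans; cong; cong₂; subst)
  open import Defs using (HasCard)

  pairs : (A → List B) → List A → List C
  pairs g [] = []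
  pairs g (a ∷ as) = map (pair a) (g a) ++ pairs g as

  module _ (g : A → List B) where

    length-pairs : ∀ as → length (pairs g as) ≡ sum (map (length ∘ g) as)
    length-pairs [] = refl
    length-pairs (a ∷ as) = trans (length-++ (map (pair a) (g a))) (cong₂ _+_ (length-map (pair a) (g a)) (length-pairs as))

    ∈-pairs⁺ : ∀ {as a b} → a ∈ as → b ∈ g a → pair a b ∈ pairs g as
    ∈-pairs⁺ {a ∷ as} (here refl) b∈ = ∈-++⁺ˡ (∈-map⁺ (pair a) b∈)
    ∈-pairs⁺ {a′ ∷ as} (there a∈) b∈ = ∈-++⁺ʳ (map (pair a′) (g a′)) (∈-pairs⁺ a∈ b∈)

    ∈-pairs⁻ : ∀ as {u} → u ∈ pairs g as → fst u ∈ as × snd u ∈ g (fst u)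
    ∈-pairs⁻ (a ∷ as) u∈ with ∈-++⁻ (map (pair a) (g a)) u∈
    ... | inj₁ u∈map with ∈-map⁻ (pair a) u∈map
    ...   | b , b∈ , refl rewrite fst-pair a b | snd-pair a b = here refl , b∈
    ∈-pairs⁻ (a ∷ as) u∈ | inj₂ u∈rest = let (fst∈ , snd∈) = ∈-pairs⁻ as u∈rest in there fst∈ , snd∈

    pairs⁺ : ∀ {as} → Unique as → (∀ a → Unique (g a)) → Unique (pairs g as)
    pairs⁺ [] _ = []
    pairs⁺ {a ∷ as} (a∉as ∷ uas) ug = Unique.++⁺ (Unique.map⁺ pair-injective (ug a)) (pairs⁺ uas ug) disjoint
      where
      pair-injective : ∀ {x y} → pair a x ≡ pair a y → x ≡ y
      pair-injective {x} {y} e = trans (sym (snd-pair a x)) (trans (cong snd e) (snd-pair a y))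
      disjoint : ∀ {u} → ¬ (u ∈ map (pair a) (g a) × u ∈ pairs g as)
      disjoint (u∈map , u∈rest) with ∈-map⁻ (pair a) u∈map
      ... | b , _ , refl = All.lookup a∉as (proj₁ (∈-pairs⁻ as u∈rest)) (sym (fst-pair a b))

  HasCard-pairs : ∀ {P : A → Set} {R : A → B → Set} {k} (cP : HasCard P k) (g : A → List B) →
                  (∀ a → Unique (g a)) → (∀ {a b} → P a → b ∈ g a ⇔ R a b) →
                  HasCard (λ u → P (fst u) × R (fst u) (snd u)) (sum (map (length ∘ g) (HasCard.elems cP)))
  HasCard-pairs {R = R} cP g ug fibre = record
    { elems = pairs g (elems cP)
    ; unique = pairs⁺ g (unique cP) ug
    ; len = length-pairs g (elems cP)
    ; sound = λ u∈ → let (fst∈ , snd∈) = ∈-pairs⁻ g (elems cP) u∈ ; Pfst = sound cP fst∈ in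
                     Pfst , Equivalence.to (fibre Pfst) snd∈
    ; complete = λ {u} (Pfst , Rfst) → subst (_∈ pairs g (elems cP)) (pair-fst-snd u)
                   (∈-pairs⁺ g (complete cP Pfst) (Equivalence.from (fibre Pfst) Rfst))
    }
    where open HasCard

  HasCard-product : ∀ {P : A → Set} {Q : B → Set} {k m} → HasCard P k → HasCard Q m →
                    HasCard (λ u → P (fst u) × Q (snd u)) (k * m)
  HasCard-product {k = k} {m} cP cQ = subst (HasCard _) (trans (sum-const (elems cP)) (cong (_* m) (len cP)))
    (HasCard-pairs cP (λ _ → elems cQ) (λ _ → unique cQ) (λ _ → mk⇔ (sound cQ) (complete cQ)))
    where
    open HasCard
    sum-const : ∀ xs → sum (map (λ _ → length (elems cQ)) xs) ≡ length xs * m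
    sum-const [] = refl
    sum-const (_ ∷ xs) = cong₂ _+_ (len cQ) (sum-const xs)

module Reduction {d : ℕ} {bs : Vec ℕ d} {b : ℕ} (i₀ : Fin d)
                 (ε : Real) (ε>0 : Real.L ε 0ℚ) (ε<1 : ∀ q → Real.L ε q → q ℚ.< 1ℚ)
                 (approx : Approximation.Approximant ε ε>0 ε<1) where

  open import Defs
  open import Data.Nat using (_+_; _*_; _≤_; _<_)
  open import Data.Nat.ListAction using (sum)
  open import Data.List using (List; []; length; filter; map)
  open import Data.List.Properties using (length-filter)
  open import Data.List.Membership.Propositional using (_∈_)
  open import Data.List.Membership.Propositional.Properties using (∈-filter⁺; ∈-filter⁻)
  open import Data.List.Relation.Unary.Unique.Propositional using (Unique)
  import Data.List.Relation.Unary.Unique.Propositional.Properties as Unique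
  open import Data.Nat.Properties using (≤-refl) renaming (_≟_ to _≟ℕ_)
  open import Data.List.Membership.DecPropositional _≟ℕ_ using () renaming (_∈?_ to _∈ℕ?_)
  open import Data.Empty using (⊥-elim)
  open import Relation.Nullary using (yes; no)
  open import Data.Product using (Σ; ∃; _×_; _,_; proj₁; proj₂)
  open import Function.Bundles using (_⇔_; mk⇔)
  open import Relation.Unary using (Decidable)
  open import Relation.Unary.Properties using (∁?)
  open import Relation.Binary.PropositionalEquality using (_≡_; refl; sym; trans; cong; subst)
  open Tuples
    using (snoc; init; last; snoc-init-last; init-snoc; last-snoc; snoc-pointwise⁻; snoc-pointwise⁺; pointwise-choice; snoc-elim)
  open import Data.List.Membership.DecPropositional (Tuples._≟_ {bs = bs ∷ʳ b}) using (_∈?_)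
  module TupleCard = Cardinality (Tuples._≟_ {bs = bs})
  module SeqCard = Cardinality (Prefix._≟_ {b})
  module SnocTupleCard = Cardinality (Tuples._≟_ {bs = bs ∷ʳ b})
  open Pairs (snoc {A = Seq} {bs = bs} {c = b}) init last init-snoc last-snoc snoc-init-last
    using (HasCard-pairs; HasCard-product)
  open VectorTrees
  open Levels using (level-unique; level-below-<; height⇒level<)
  open StrongSubtrees using (level-inclusion; StrongSubtree-trans)
  open Approximation ε ε>0 ε<1 using (upper-bound⇒half-≤ᶜ; ≤ᶜ⇒lower-bound)
  open Averaging using (heavy?; averaging-fibres; length-heavy+light; weighted-sum-bound)

  open Real ε using (L)
  open Approximation.Approximant approx

  module Split (T′ : VTree bs) (W : Tree b)
               (T-homogeneous : ∀ i → Homogeneous (get (snoc T′ W) i) × Infinite (get (snoc T′ W) i))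
               (D : Tuple (bs ∷ʳ b) → Set) (D⊆⊗T : ∀ u → D u → Σ ℕ λ n → LevelProd (snoc T′ W) n u) where

    T : VTree (bs ∷ʳ b)
    T = snoc T′ W

    T′-homogeneous : ∀ i → Homogeneous (get T′ i) × Infinite (get T′ i)
    T′-homogeneous = proj₁ (snoc-pointwise⁻ (λ X _ → Homogeneous X × Infinite X) T′ W T′ W T-homogeneous)

    W-homogeneous : Homogeneous W × Infinite W
    W-homogeneous = proj₂ (snoc-pointwise⁻ (λ X _ → Homogeneous X × Infinite X) T′ W T′ W T-homogeneous)

    level-product-split : ∀ {n u} → LevelProd T n u → LevelProd T′ n (init u) × Level W n (last u)
    level-product-split {u = u} T[n]u =
      level-product-snoc⁻ T′ W (init u) (last u) (subst (LevelProd T _) (sym (snoc-init-last u)) T[n]u)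

    level-product-merge : ∀ {n u} → LevelProd T′ n (init u) × Level W n (last u) → LevelProd T n u
    level-product-merge {u = u} (T′[n] , W[n]) =
      subst (LevelProd T _) (snoc-init-last u) (level-product-snoc⁺ T′ W (init u) (last u) T′[n] W[n])

    Fibre : Tuple bs → Tree b
    Fibre t w = D (snoc t w)

    -- The level of a tuple is determined by any single coordinate; i₀ (which needs d ≥ 1) is the one used.
    fibre⊆level : ∀ {n t w} → Level (get T′ i₀) n (get t i₀) → Fibre t w → Level W n w
    fibre⊆level {t = t} {w} T′ᵢ[n]t Dtw with D⊆⊗T _ Dtw
    ... | m , T[m] = let (T′[m]t , W[m]w) = level-product-snoc⁻ T′ W t w T[m] in
                     subst (λ l → Level W l w) (level-unique (T′[m]t i₀) T′ᵢ[n]t) W[m]w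

    DenseFibre : ℕ → Tuple bs → Set
    DenseFibre n t = LevelProd T′ n t × DensGe (half L) W (Fibre t)

    record DenseFibres (n : ℕ) : Set where
      field
        tuples     : List (Tuple bs)
        unique     : Unique tuples
        dense      : ∀ {t} → t ∈ tuples → DenseFibre n t
        size       : ℕ
        level-size : HasCard (LevelProd T′ n) size
        density    : half L · size ≤ᶜ length tuples

    module AtLevel (n c tot : ℕ) (D[n] : HasCard (λ u → D u × LevelProd T n u) c)
                   (T[n] : HasCard (LevelProd T n) tot) (ε·tot≤c : L · tot ≤ᶜ c) where

      open HasCard

      T′[n]-finite : Σ ℕ (HasCard (LevelProd T′ n))
      T′[n]-finite = TupleCard.HasCard-image init T[n]
        (mk⇔ extend λ { (u , T[n]u , refl) → proj₁ (level-product-split T[n]u) })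
        where
        extend : ∀ {t} → LevelProd T′ n t → ∃ λ u → LevelProd T n u × init u ≡ t
        extend {t} T′[n]t = let (w , W[n]w) = proj₂ W-homogeneous n in
          snoc t w , level-product-snoc⁺ T′ W t w T′[n]t W[n]w , init-snoc t w

      W[n]-finite : Σ ℕ (HasCard (Level W n))
      W[n]-finite = SeqCard.HasCard-image last T[n]
        (mk⇔ extend λ { (u , T[n]u , refl) → proj₂ (level-product-split T[n]u) })
        where
        extend : ∀ {w} → Level W n w → ∃ λ u → LevelProd T n u × last u ≡ w
        extend {w} W[n]w =
          let (t , T′[n]t) = pointwise-choice T′ (λ X s → Level X n s) (λ i → proj₂ (T′-homogeneous i) n) in
          snoc t w , level-product-snoc⁺ T′ W t w T′[n]t W[n]w , last-snoc t w

      p m : ℕ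
      p = proj₁ T′[n]-finite
      m = proj₁ W[n]-finite

      T′[n] : HasCard (LevelProd T′ n) p
      T′[n] = proj₂ T′[n]-finite

      W[n] : HasCard (Level W n) m
      W[n] = proj₂ W[n]-finite

      in-D? : ∀ t → Decidable (λ w → snoc t w ∈ elems D[n])
      in-D? t w = snoc t w ∈? elems D[n]

      fibre-list : Tuple bs → List (Seq b)
      fibre-list t = filter (in-D? t) (elems W[n])

      fibre-size : Tuple bs → ℕ
      fibre-size t = length (fibre-list t)

      fibre-list-unique : ∀ t → Unique (fibre-list t)
      fibre-list-unique t = Unique.filter⁺ (in-D? t) {elems W[n]} (unique W[n])

      ∈-fibre-list : ∀ {t w} → LevelProd T′ n t → w ∈ fibre-list t ⇔ Fibre t w
      ∈-fibre-list {t} {w} T′[n]t = mk⇔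
        (λ w∈ → proj₁ (sound D[n] (proj₂ (∈-filter⁻ (in-D? t) {xs = elems W[n]} w∈))))
        (λ Dtw → let W[n]w = fibre⊆level (T′[n]t i₀) Dtw in
                 ∈-filter⁺ (in-D? t) (complete W[n] W[n]w)
                   (complete D[n] (Dtw , level-product-snoc⁺ T′ W t w T′[n]t W[n]w)))

      fibre-card : ∀ {t} → LevelProd T′ n t → HasCard (Fibre t) (fibre-size t)
      fibre-card {t} T′[n]t = SeqCard.HasCard-cong (∈-fibre-list T′[n]t)
        (record { elems = fibre-list t ; unique = fibre-list-unique t ; len = refl
                ; sound = λ w∈ → w∈ ; complete = λ w∈ → w∈ })

      fibre-size≤m : ∀ t → fibre-size t ≤ m
      fibre-size≤m t = subst (fibre-size t ≤_) (len W[n]) (length-filter (in-D? t) (elems W[n]))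

      tot≡p*m : tot ≡ p * m
      tot≡p*m = SnocTupleCard.HasCard-unique T[n]
        (SnocTupleCard.HasCard-cong (mk⇔ level-product-merge level-product-split) (HasCard-product T′[n] W[n]))

      c≡∑fibre-size : c ≡ sum (map fibre-size (elems T′[n]))
      c≡∑fibre-size = SnocTupleCard.HasCard-unique D[n]
        (SnocTupleCard.HasCard-cong (mk⇔ merge split)
          (HasCard-pairs T′[n] fibre-list fibre-list-unique ∈-fibre-list))
        where
        merge : ∀ {u} → LevelProd T′ n (init u) × Fibre (init u) (last u) → D u × LevelProd T n u
        merge {u} (T′[n] , Dfib) =
          subst D (snoc-init-last u) Dfib , level-product-merge (T′[n] , fibre⊆level (T′[n] i₀) Dfib)
        split : ∀ {u} → D u × LevelProd T n u → LevelProd T′ n (init u) × Fibre (init u) (last u)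
        split {u} (Du , T[n]u) = proj₁ (level-product-split T[n]u) , subst D (sym (snoc-init-last u)) Du

      heavy-fibre? : Decidable (λ t → (8 + A) * m ≤ (fibre-size t + fibre-size t) * (4 + A + B))
      heavy-fibre? = heavy? fibre-size m (4 + A + B) (8 + A)

      heavy : List (Tuple bs)
      heavy = filter heavy-fibre? (elems T′[n])

      e f : ℕ
      e = length heavy
      f = length (filter (∁? heavy-fibre?) (elems T′[n]))

      heavy-dense : ∀ {t} → t ∈ heavy → DenseFibre n t
      heavy-dense {t} t∈ =
        let (t∈T′[n] , t-heavy) = ∈-filter⁻ heavy-fibre? {xs = elems T′[n]} t∈
            T′[n]t = sound T′[n] t∈T′[n]
        in T′[n]t , n , proj₂ W-homogeneous n , (λ w → fibre⊆level (T′[n]t i₀)) ,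
           fibre-size t , m , fibre-card T′[n]t , W[n] , upper-bound⇒half-≤ᶜ approx {m} {fibre-size t} t-heavy

      heavy-density : half L · p ≤ᶜ e
      heavy-density = upper-bound⇒half-≤ᶜ approx {p} {e}
        (subst (λ z → (8 + A) * z ≤ (e + e) * (4 + A + B)) p≡e+f
          (averaging-fibres A B e f m c A≥1 narrow m≥1 lower-bound weighted-bound))
        where
        p≡e+f : e + f ≡ p
        p≡e+f = trans (length-heavy+light fibre-size m (4 + A + B) (8 + A) (elems T′[n])) (len T′[n])
        m≥1 : 1 ≤ m
        m≥1 = SeqCard.HasCard-positive W[n] (proj₂ (proj₂ W-homogeneous n))
        lower-bound : (4 + A) * ((e + f) * m) ≤ c * (4 + A + B)
        lower-bound = subst (λ z → (4 + A) * z ≤ c * (4 + A + B))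
          (trans tot≡p*m (cong (_* m) (sym p≡e+f))) (≤ᶜ⇒lower-bound approx {tot} {c} ε·tot≤c)
        weighted-bound : (c + c) * (4 + A + B) ≤ ((m + m) * (4 + A + B)) * e + ((8 + A) * m) * f
        weighted-bound = subst (λ z → (z + z) * (4 + A + B) ≤ ((m + m) * (4 + A + B)) * e + ((8 + A) * m) * f)
          (sym c≡∑fibre-size)
          (weighted-sum-bound fibre-size m (4 + A + B) (8 + A) (elems T′[n]) fibre-size≤m)

      dense-fibres : DenseFibres n
      dense-fibres = record
        { tuples = heavy ; unique = Unique.filter⁺ heavy-fibre? {elems T′[n]} (unique T′[n])
        ; dense = heavy-dense ; size = p ; level-size = T′[n] ; density = heavy-density }

    module OverLevels (levels : List ℕ)
                (ε-dense : ∀ n → n ∈ levels → Σ ℕ λ c → Σ ℕ λ tot →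
                   HasCard (λ u → D u × LevelProd T n u) c × HasCard (LevelProd T n) tot × (L · tot ≤ᶜ c)) where

      fibres-at : ∀ n → n ∈ levels → DenseFibres n
      fibres-at n n∈ =
        let (c , tot , D[n] , T[n] , ε·tot≤c) = ε-dense n n∈ in AtLevel.dense-fibres n c tot D[n] T[n] ε·tot≤c

      -- Deciding n ∈ levels makes the selected tuples a function of n alone.
      selected : ℕ → List (Tuple bs)
      selected n with n ∈ℕ? levels
      ... | yes n∈ = DenseFibres.tuples (fibres-at n n∈)
      ... | no _ = []

      selected-dense : ∀ {n t} → t ∈ selected n → DenseFibre n t
      selected-dense {n} t∈ with n ∈ℕ? levels
      ... | yes n∈ = DenseFibres.dense (fibres-at n n∈) t∈

      selected-fibres : ∀ {n} → n ∈ levels → Σ (DenseFibres n) λ F → selected n ≡ DenseFibres.tuples F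
      selected-fibres {n} n∈ with n ∈ℕ? levels
      ... | yes n∈′ = fibres-at n n∈′ , refl
      ... | no n∉ = ⊥-elim (n∉ n∈)

      D′ : Tuple bs → Set
      D′ t = Σ ℕ λ n → t ∈ selected n

      D′⊆⊗T′ : ∀ t → D′ t → Σ ℕ λ n → LevelProd T′ n t
      D′⊆⊗T′ t (n , t∈) = n , proj₁ (selected-dense t∈)

      D′-dense : ∀ n → n ∈ levels → Σ ℕ λ c → Σ ℕ λ p →
                 HasCard (λ t → D′ t × LevelProd T′ n t) c × HasCard (LevelProd T′ n) p × (half L · p ≤ᶜ c)
      D′-dense n n∈ with selected-fibres n∈
      ... | F , selected≡ = length tuples , size , D′[n] , level-size , density
        where
        open DenseFibres F
        D′[n] : HasCard (λ t → D′ t × LevelProd T′ n t) (length tuples)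
        D′[n] = record
          { elems = tuples ; unique = unique ; len = refl
          ; sound = λ {t} t∈ → (n , subst (t ∈_) (sym selected≡) t∈) , proj₁ (dense t∈)
          ; complete = λ { {t} ((n′ , t∈) , T′[n]t) →
              subst (t ∈_) selected≡ (subst (λ l → t ∈ selected l)
                (level-unique {T = get T′ i₀} (proj₁ (selected-dense t∈) i₀) (T′[n]t i₀)) t∈) }
          }

      module Selection {M : ℕ} (S : VTree bs)
                       (S-strong : ∀ i → StrongSubtree (get T′ i) (get S i) × Height (get S i) M)
                       (⊗S⊆D′ : ∀ n t → LevelProd S n t → D′ t) where

        level : ℕ → ℕ
        level n = proj₁ (level-inclusion (proj₁ (S-strong i₀)) n)

        S[n]⊆T′[level-n] : ∀ {n x} → Level (get S i₀) n x → Level (get T′ i₀) (level n) x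
        S[n]⊆T′[level-n] {n} = proj₂ (level-inclusion (proj₁ (S-strong i₀)) n) _

        level-<-mono : ∀ m n → m < n → n < M → level m < level n
        level-<-mono m n m<n n<M with proj₁ (proj₂ (S-strong i₀)) n n<M
        ... | y , S[n]y with level-below-< m<n S[n]y
        ...   | z , S[m]z , z⊏y = Levels.level-<-mono (S[n]⊆T′[level-n] S[m]z) (S[n]⊆T′[level-n] S[n]y) z⊏y

        fibre-selection : IsLevelSelection S M W Fibre
        fibre-selection =
          level , level-<-mono , λ n t _ S[n]t w Dtw → fibre⊆level (S[n]⊆T′[level-n] (S[n]t i₀)) Dtw

        fibre-dense : ∀ n t → LevelProd S n t → DensGe (half L) W (Fibre t)
        fibre-dense n t S[n]t = proj₂ (selected-dense (proj₂ (⊗S⊆D′ n t S[n]t)))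

        S-finite : FinVHomogeneous S M
        S-finite i = StrongSubtree-trans (proj₁ (T′-homogeneous i)) (proj₁ (S-strong i)) , proj₂ (S-strong i)

        reduction : ∀ {k} → LSProp bs b k (half L) M →
                    Σ (VTree (bs ∷ʳ b)) λ U → (∀ i → StrongSubtree (get T i) (get U i) × Height (get U i) k) ×
                    CommonLevelSet T U × (∀ n u → LevelProd U n u → D u)
        reduction {k} LS-M with LS-M S M S-finite W (proj₁ W-homogeneous) Fibre fibre-selection ≤-refl fibre-dense
        ... | S′ , R , (S′-strong , _) , S′-height , R-strong , R-height , R⊆fibres =
          U , U-strong , common-level-set T U k U-strong (λ n _ u U[n]u → D⊆⊗T u (⊗U⊆D n u U[n]u)) , ⊗U⊆D
          where
          U : VTree (bs ∷ʳ b)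
          U = snoc S′ R
          U-strong : ∀ i → StrongSubtree (get T i) (get U i) × Height (get U i) k
          U-strong = snoc-pointwise⁺ (λ X Y → StrongSubtree X Y × Height Y k) T′ W S′ R
            (λ i → StrongSubtree-trans (proj₁ (S-strong i)) (S′-strong i) , S′-height i) (R-strong , R-height)
          ⊗U⊆D : ∀ n u → LevelProd U n u → D u
          ⊗U⊆D n u U[n]u =
            let (S′[n] , R[n]) = level-product-snoc⁻ S′ R (init u) (last u)
                                   (subst (LevelProd U n) (sym (snoc-init-last u)) U[n]u)
            in subst D (snoc-init-last u) (R⊆fibres n (height⇒level< R-height R[n]) (last u) R[n] (init u) S′[n])

      reduction : ∀ {M k N} → LSProp bs b k (half L) M → UDHLProp bs M (half L) N →
                  Unique levels → N ≤ length levels →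
                  Σ (VTree (bs ∷ʳ b)) λ U → (∀ i → StrongSubtree (get T i) (get U i) × Height (get U i) k) ×
                  CommonLevelSet T U × (∀ n u → LevelProd U n u → D u)
      reduction LS-M UDHL-N levels-unique N≤|levels|
        with UDHL-N T′ T′-homogeneous levels levels-unique N≤|levels| D′ D′⊆⊗T′ D′-dense
      ... | S , S-strong , _ , ⊗S⊆D′ = Selection.reduction S S-strong ⊗S⊆D′ LS-M

  UDHL-step : ∀ {M k N} → LSProp bs b k (half L) M → UDHLProp bs M (half L) N → UDHLProp (bs ∷ʳ b) k L N
  UDHL-step LS-M UDHL-N = snoc-elim λ T′ W T-homogeneous levels levels-unique N≤|levels| D D⊆⊗T ε-dense →
    Split.OverLevels.reduction T′ W T-homogeneous D D⊆⊗T levels ε-dense LS-M UDHL-N levels-unique N≤|levels|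

open import Defs
open import Data.Nat using (ℕ; _≤_; suc)
open import Data.Fin using (zero)
open import Data.Vec using (Vec; _∷ʳ_)
open import Data.Vec.Relation.Unary.All using (All)
open import Data.Rational using (0ℚ; 1ℚ; _<_)
open import Data.Product using (_,_)

fact3p3 : (d : ℕ) → 1 ≤ d → (bs : Vec ℕ d) → (b : ℕ) →
    All (2 ≤_) bs → 2 ≤ b → (k : ℕ) → 1 ≤ k →
    (ε : Real) → Real.L ε 0ℚ → (∀ q → Real.L ε q → q < 1ℚ) →
    (M N N' : ℕ) →
    IsLeast (LSProp bs b k (half (Real.L ε))) M →
    IsLeast (UDHLProp bs M (half (Real.L ε))) N →
    IsLeast (UDHLProp (bs ∷ʳ b) k (Real.L ε)) N' →
    N' ≤ N
fact3p3 (suc _) _ bs b _ _ k _ ε ε>0 ε<1 M N N′ (LS-M , _) (UDHL-N , _) (_ , N′-least) =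
  N′-least N (Reduction.UDHL-step zero ε ε>0 ε<1 (Approximation.approximant ε ε>0 ε<1) LS-M UDHL-N)
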